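{- Let $p$ be a prime with $p\equiv 3\pmod 4$ and write the continued fraction of $\sqrt{p}$ as $[x_0;\overline{x_1,\dots,x_k,\dots,x_1,2x_0}]$ with minimal period of length $P$. Then: (i) $P=2k$ is even, and moreover $P\equiv 2\pmod 4$ if $p\equiv 3\pmod 8$, while $P\equiv 0\pmod 4$ if $p\equiv 7\pmod 8$; (ii) either $x_k=x_0$ (culminating period), or $x_k=x_0-1$ and $x_{k-1}=1$ (almost-culminating period).
   Context: The period is symmetric: its entries $x_1,\dots,x_{P-1}$ satisfy $x_i=x_{P-i}$ and the last entry is $2x_0$; $x_k$ denotes the middle entry of the period when $P=2k$. -}

module Defs where

open import Data.Nat using (ℕ; zero; suc; _+_; _*_; _∸_; _<_; _≤?_; _/_)
open import Data.Product using (_×_; _,_)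
open import Relation.Nullary using (yes; no)

isqrt : ℕ → ℕ
isqrt-step : ℕ → ℕ → ℕ
isqrt-step n r with suc r * suc r ≤? n
... | yes _ = suc r
... | no  _ = r
isqrt zero = zero
isqrt (suc n) = isqrt-step (suc n) (isqrt n)

-- total division (the divisor is never 0 in the uses below)
_div_ : ℕ → ℕ → ℕ
m div zero = zero
m div suc d = m / suc d

-- floor of the quadratic irrational (m + √n)/d, for d > 0:
-- ⌊(m + √n)/d⌋ = ⌊(m + ⌊√n⌋)/d⌋
flr : ℕ → ℕ → ℕ → ℕ
flr n m d = (m + isqrt n) div d

-- The i-th complete quotient of √n is α_i = (m_i + √n)/d_i ;
-- α_0 = √n, α_{i+1} = 1/(α_i - ⌊α_i⌋), computed exactly by the standard
-- recurrences m_{i+1} = a_i d_i - m_i,  d_{i+1} = (n - m_{i+1}²)/d_i.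
cqState : ℕ → ℕ → ℕ × ℕ
cqState n zero = 0 , 1
cqState n (suc i) with cqState n i
... | m , d = let a = flr n m d
                  m' = a * d ∸ m
              in m' , ((n ∸ m' * m') div d)

cf : ℕ → ℕ → ℕ
cf n i with cqState n i
... | m , d = flr n m d

IsPeriod : ℕ → ℕ → Set
IsPeriod n P = 0 < P × (∀ i → 1 Data.Nat.≤ i → cf n (i + P) ≡ cf n i)
  where open import Relation.Binary.PropositionalEquality using (_≡_)

IsMinPeriod : ℕ → ℕ → Set
IsMinPeriod n P = IsPeriod n P × (∀ Q → 0 < Q → Q < P → IsPeriod n Q → ⊥)
  where open import Data.Empty using (⊥)

{-# OPTIONS --safe #-}
module Submission where

-- Write the complete quotients of √p as α_i = (m_i + √p)/d_i. For i ≥ 1 they are reduced,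
-- and on reduced states the step α ↦ 1/(α − ⌊α⌋) is injective, with inverse given by the
-- reflection α ↦ −1/ᾱ. By pigeonhole the expansion returns to α = a₀ + √p, which closes each
-- period, and the reflection maps α_{i+1} to α_{P−i}. For odd P the middle state would give
-- p = m² + d², impossible when p ≡ 3 (mod 4). For P = 2k the middle state has m_{k+1} = m_k,
-- so d_k divides 2 m_k and, p being prime, d_k = 2; hence x_k = m_k ∈ {a₀ − 1, a₀}, and when
-- x_k = a₀ − 1 one finds d_{k−1} > a₀, i.e. x_{k−1} = 1. Finally the convergent identity
-- p_{k−1}² − p q_{k−1}² = (−1)^k d_k = ±2 is read modulo 8, which ties the parity of k to p mod 8.

open import Defs
open import Data.Nat
open import Data.Nat.Properties
open import Data.Nat.DivMod hiding (_div_)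
open import Data.Nat.Divisibility using (_∣_; divides; ∣-trans; m∣m*n; ∣m∣n⇒∣m+n; ∣⇒≤)
open import Data.Nat.Coprimality using (Coprime; coprime-divisor)
open import Data.Nat.Primality using (Prime; prime⇒irreducible)
open import Data.Nat.Tactic.RingSolver using (solve; solve-∀)
open import Data.List using (_∷_; [])
open import Data.Product
open import Data.Fin as Fin using (Fin)
open import Data.Fin.Properties using (pigeonhole; combine-injective; toℕ-fromℕ<)
open import Data.Sum using (_⊎_; inj₁; inj₂)
import Data.Sum as Sum
open import Data.Empty using (⊥-elim)
open import Function using (_∘_)
open import Relation.Binary.PropositionalEquality
open import Relation.Nullary using (yes; no; ¬?)
open import Relation.Nullary.Decidable using (from-yes)

module _ (d : ℕ) .{{_ : NonZero d}} where

  %-cong-+ : ∀ a a′ b b′ → a % d ≡ a′ % d → b % d ≡ b′ % d → (a + b) % d ≡ (a′ + b′) % d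
  %-cong-+ a a′ b b′ a≡a′ b≡b′ = begin
    (a + b) % d            ≡⟨ %-distribˡ-+ a b d ⟩
    (a % d + b % d) % d    ≡⟨ cong₂ (λ u v → (u + v) % d) a≡a′ b≡b′ ⟩
    (a′ % d + b′ % d) % d  ≡⟨ %-distribˡ-+ a′ b′ d ⟨
    (a′ + b′) % d          ∎
    where open ≡-Reasoning

  %-cong-* : ∀ a a′ b b′ → a % d ≡ a′ % d → b % d ≡ b′ % d → (a * b) % d ≡ (a′ * b′) % d
  %-cong-* a a′ b b′ a≡a′ b≡b′ = begin
    (a * b) % d              ≡⟨ %-distribˡ-* a b d ⟩
    (a % d * (b % d)) % d    ≡⟨ cong₂ (λ u v → (u * v) % d) a≡a′ b≡b′ ⟩
    (a′ % d * (b′ % d)) % d  ≡⟨ %-distribˡ-* a′ b′ d ⟨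
    (a′ * b′) % d            ∎
    where open ≡-Reasoning

  [x%d]²%d≡x²%d : ∀ x → (x % d * (x % d)) % d ≡ (x * x) % d
  [x%d]²%d≡x²%d x = %-cong-* (x % d) x (x % d) x (m%n%n≡m%n x d) (m%n%n≡m%n x d)

x*x+y*y%4≢3 : ∀ x y → (x * x + y * y) % 4 ≢ 3
x*x+y*y%4≢3 x y = residues (m%n<n x 4) (m%n<n y 4) ∘
  trans (%-cong-+ 4 (x % 4 * (x % 4)) (x * x) (y % 4 * (y % 4)) (y * y) ([x%d]²%d≡x²%d 4 x) ([x%d]²%d≡x²%d 4 y))
  where
  residues : ∀ {r} → r < 4 → ∀ {s} → s < 4 → (r * r + s * s) % 4 ≢ 3
  residues = from-yes (allUpTo? (λ r → allUpTo? (λ s → ¬? ((r * r + s * s) % 4 ≟ 3)) 4) 4)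

p%8≡3⇒x*x≢p*[y*y]+2 : ∀ {p} → p % 8 ≡ 3 → ∀ x y → x * x ≢ p * (y * y) + 2
p%8≡3⇒x*x≢p*[y*y]+2 {p} p%8≡3 x y eq = residues (m%n<n x 8) (m%n<n y 8) (begin
  (x % 8 * (x % 8)) % 8            ≡⟨ [x%d]²%d≡x²%d 8 x ⟩
  (x * x) % 8                      ≡⟨ cong (_% 8) eq ⟩
  (p * (y * y) + 2) % 8            ≡⟨ %-cong-+ 8 (p * (y * y)) (3 * (y % 8 * (y % 8))) 2 2
                                        (%-cong-* 8 p 3 (y * y) (y % 8 * (y % 8)) p%8≡3 (sym ([x%d]²%d≡x²%d 8 y))) refl ⟩
  (3 * (y % 8 * (y % 8)) + 2) % 8  ∎)
  where
  open ≡-Reasoning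
  residues : ∀ {r} → r < 8 → ∀ {s} → s < 8 → (r * r) % 8 ≢ (3 * (s * s) + 2) % 8
  residues = from-yes (allUpTo? (λ r → allUpTo? (λ s → ¬? ((r * r) % 8 ≟ (3 * (s * s) + 2) % 8)) 8) 8)

p%8≡7⇒p*[y*y]≢x*x+2 : ∀ {p} → p % 8 ≡ 7 → ∀ x y → p * (y * y) ≢ x * x + 2
p%8≡7⇒p*[y*y]≢x*x+2 {p} p%8≡7 x y eq = residues (m%n<n x 8) (m%n<n y 8) (begin
  (x % 8 * (x % 8) + 2) % 8        ≡⟨ %-cong-+ 8 (x % 8 * (x % 8)) (x * x) 2 2 ([x%d]²%d≡x²%d 8 x) refl ⟩
  (x * x + 2) % 8                  ≡⟨ cong (_% 8) eq ⟨
  (p * (y * y)) % 8                ≡⟨ %-cong-* 8 p 7 (y * y) (y % 8 * (y % 8)) p%8≡7 (sym ([x%d]²%d≡x²%d 8 y)) ⟩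
  (7 * (y % 8 * (y % 8))) % 8      ∎)
  where
  open ≡-Reasoning
  residues : ∀ {r} → r < 8 → ∀ {s} → s < 8 → (r * r + 2) % 8 ≢ (7 * (s * s)) % 8
  residues = from-yes (allUpTo? (λ r → allUpTo? (λ s → ¬? ((r * r + 2) % 8 ≟ (7 * (s * s)) % 8)) 8) 8)

isqrt-spec : ∀ n → isqrt n * isqrt n ≤ n × n < suc (isqrt n) * suc (isqrt n)
isqrt-spec zero    = z≤n , s≤s z≤n
isqrt-spec (suc n) = extend (isqrt n) (isqrt-spec n)
  where
  extend : ∀ r → r * r ≤ n × n < suc r * suc r →
    let r′ = isqrt-step (suc n) r in r′ * r′ ≤ suc n × suc n < suc r′ * suc r′
  extend r (r²≤n , n<[1+r]²) with suc r * suc r ≤? suc n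
  ... | yes [1+r]²≤1+n = [1+r]²≤1+n , ≤-<-trans n<[1+r]² (*-mono-< (n<1+n (suc r)) (n<1+n (suc r)))
  ... | no  [1+r]²≰1+n = m≤n⇒m≤1+n r²≤n , ≰⇒> [1+r]²≰1+n

[m-div-d]*d≤m : ∀ m {d} → 0 < d → (m div d) * d ≤ m
[m-div-d]*d≤m m {suc d} _ = m/n*n≤m m (suc d)

m<[m-div-d]*d+d : ∀ m {d} → 0 < d → m < (m div d) * d + d
m<[m-div-d]*d+d m {suc d} _ = begin-strict
  m                                ≡⟨ m≡m%n+[m/n]*n m (suc d) ⟩
  m % suc d + (m / suc d) * suc d  <⟨ +-monoˡ-< _ (m%n<n m (suc d)) ⟩
  suc d + (m / suc d) * suc d      ≡⟨ +-comm (suc d) _ ⟩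
  (m / suc d) * suc d + suc d      ∎
  where open ≤-Reasoning

div-unique : ∀ {m d} q → 0 < d → q * d ≤ m → m < q * d + d → m div d ≡ q
div-unique {m} {suc d} q _ qd≤m m<qd+d = ≤-antisym m/d≤q q≤m/d
  where
  q≤m/d : q ≤ m / suc d
  q≤m/d = subst (_≤ m / suc d) (m*n/n≡m q (suc d)) (/-monoˡ-≤ (suc d) qd≤m)
  m/d≤q : m / suc d ≤ q
  m/d≤q = s≤s⁻¹ (*-cancelʳ-< (suc d) (m / suc d) (suc q) (≤-<-trans (m/n*n≤m m (suc d))
            (subst (m <_) (+-comm (q * suc d) (suc d)) m<qd+d)))

cofactor : ∀ {n m d e} → 0 < d → m * m + d * e ≡ n → (n ∸ m * m) div d ≡ e
cofactor {m = m} {suc d} {e} _ refl = begin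
  (m * m + suc d * e ∸ m * m) / suc d  ≡⟨ cong (_/ suc d) (m+n∸m≡n (m * m) (suc d * e)) ⟩
  suc d * e / suc d                    ≡⟨ cong (_/ suc d) (*-comm (suc d) e) ⟩
  e * suc d / suc d                    ≡⟨ m*n/n≡m e (suc d) ⟩
  e                                    ∎
  where open ≡-Reasoning

u≤x+y⇒u*u≤y*y+x*[y+u] : ∀ x y u → u ≤ x + y → u * u ≤ y * y + x * (y + u)
u≤x+y⇒u*u≤y*y+x*[y+u] x y u u≤x+y = +-cancelʳ-≤ (y * u) _ _ (begin
  u * u + y * u               ≡⟨ solve (u ∷ y ∷ []) ⟩
  u * (y + u)                 ≤⟨ *-monoˡ-≤ (y + u) u≤x+y ⟩
  (x + y) * (y + u)           ≡⟨ solve (x ∷ y ∷ u ∷ []) ⟩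
  y * y + x * (y + u) + y * u ∎)
  where open ≤-Reasoning

e+y≤w⇒x≤w+y⇒y*y+x*e≤w*w : ∀ x y e w → e + y ≤ w → x ≤ w + y → y * y + x * e ≤ w * w
e+y≤w⇒x≤w+y⇒y*y+x*e≤w*w x y e w e+y≤w x≤w+y = +-cancelʳ-≤ (w * y) _ _ (begin
  y * y + x * e + w * y       ≤⟨ +-monoˡ-≤ (w * y) (+-monoʳ-≤ (y * y) (*-monoˡ-≤ e x≤w+y)) ⟩
  y * y + (w + y) * e + w * y ≡⟨ solve (y ∷ w ∷ e ∷ []) ⟩
  (w + y) * (e + y)           ≤⟨ *-monoʳ-≤ (w + y) e+y≤w ⟩
  (w + y) * w                 ≡⟨ solve (w ∷ y ∷ []) ⟩
  w * w + w * y               ∎)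
  where open ≤-Reasoning

norm-after-shift : ∀ {n m m′ d e} q → 0 < d → m′ + m ≡ q * d → m * m + d * e ≡ n → m′ * m′ ≤ n →
  Σ ℕ λ e′ → m′ * m′ + d * e′ ≡ n × e′ + q * m′ ≡ e + q * m
norm-after-shift {n} {m} {m′} {d} {e} q d>0 shift norm m′²≤n with ≤-total m′ m
... | inj₁ m′≤m with t , refl ← m≤n⇒∃[o]m+o≡n m′≤m =
  t * q + e , norm′ , solve (t ∷ q ∷ e ∷ m′ ∷ [])
  where
  norm′ : m′ * m′ + d * (t * q + e) ≡ n
  norm′ = begin
    m′ * m′ + d * (t * q + e)             ≡⟨ solve (m′ ∷ d ∷ t ∷ q ∷ e ∷ []) ⟩
    m′ * m′ + d * e + t * (q * d)         ≡⟨ cong (λ z → m′ * m′ + d * e + t * z) shift ⟨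
    m′ * m′ + d * e + t * (m′ + (m′ + t)) ≡⟨ solve (m′ ∷ d ∷ e ∷ t ∷ []) ⟩
    (m′ + t) * (m′ + t) + d * e           ≡⟨ norm ⟩
    n                                     ∎
    where open ≡-Reasoning
... | inj₂ m≤m′ with t , refl ← m≤n⇒∃[o]m+o≡n m≤m′ = lift (m≤n⇒∃[o]m+o≡n tq≤e)
  where
  m′² : (m + t) * (m + t) ≡ m * m + t * q * d
  m′² = begin
    (m + t) * (m + t)            ≡⟨ solve (m ∷ t ∷ []) ⟩
    m * m + t * ((m + t) + m)    ≡⟨ cong (λ z → m * m + t * z) shift ⟩
    m * m + t * (q * d)          ≡⟨ solve (m ∷ t ∷ q ∷ d ∷ []) ⟩
    m * m + t * q * d            ∎
    where open ≡-Reasoning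
  tq≤e : t * q ≤ e
  tq≤e = *-cancelʳ-≤ (t * q) e d {{>-nonZero d>0}} (+-cancelˡ-≤ (m * m) _ _ (begin
    m * m + t * q * d  ≡⟨ m′² ⟨
    (m + t) * (m + t)  ≤⟨ m′²≤n ⟩
    n                  ≡⟨ norm ⟨
    m * m + d * e      ≡⟨ cong (m * m +_) (*-comm d e) ⟩
    m * m + e * d      ∎))
    where open ≤-Reasoning
  lift : (Σ ℕ λ u → t * q + u ≡ e) → Σ ℕ λ e′ → (m + t) * (m + t) + d * e′ ≡ n × e′ + q * (m + t) ≡ e + q * m
  lift (u , refl) = u , norm′ , solve (u ∷ q ∷ m ∷ t ∷ [])
    where
    norm′ : (m + t) * (m + t) + d * u ≡ n
    norm′ = begin
      (m + t) * (m + t) + d * u      ≡⟨ cong (_+ d * u) m′² ⟩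
      m * m + t * q * d + d * u      ≡⟨ solve (m ∷ t ∷ q ∷ d ∷ u ∷ []) ⟩
      m * m + d * (t * q + u)        ≡⟨ norm ⟩
      n                              ∎
      where open ≡-Reasoning

a*a<n⇒a+a<n : ∀ {a n} → 3 ≤ n → a * a < n → a + a < n
a*a<n⇒a+a<n {zero}        3≤n _   = <-≤-trans (s≤s z≤n) 3≤n
a*a<n⇒a+a<n {suc zero}    3≤n _   = 3≤n
a*a<n⇒a+a<n {suc (suc a)} {n} _ a²<n = ≤-<-trans (m≤m+n _ (a * a + a + a)) (subst (_< n) ([2+a]² a) a²<n)
  where
  [2+a]² : ∀ a → suc (suc a) * suc (suc a) ≡ suc (suc a) + suc (suc a) + (a * a + a + a)
  [2+a]² = solve-∀

m*2≡m+m : ∀ m → m * 2 ≡ m + m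
m*2≡m+m = solve-∀

-- The denominator d divides 2m and is coprime to m (a common factor would divide p).
denominator-two : ∀ {p m d e} q → Prime p → m + m ≡ q * d → m * m + d * e ≡ p →
  0 < d → d < p → d ≢ 1 → d ≡ 2
denominator-two {p} {m} {d} {e} q p-prime shift norm 0<d d<p d≢1 = ≤-antisym (∣⇒≤ d∣2) (≤∧≢⇒< 0<d (d≢1 ∘ sym))
  where
  coprime : Coprime d m
  coprime (i∣d , i∣m)
    with prime⇒irreducible p-prime (subst (_ ∣_) norm (∣m∣n⇒∣m+n (∣-trans i∣m (m∣m*n m)) (∣-trans i∣d (m∣m*n e))))
  ... | inj₁ i≡1 = i≡1
  ... | inj₂ refl = ⊥-elim (<⇒≱ d<p (∣⇒≤ {{>-nonZero 0<d}} i∣d))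
  d∣2 : d ∣ 2
  d∣2 = coprime-divisor coprime (divides q (trans (m*2≡m+m m) shift))

even-or-odd : ∀ n → Σ ℕ λ k → n ≡ k + k ⊎ n ≡ suc (k + k)
even-or-odd zero = 0 , inj₁ refl
even-or-odd (suc n) with even-or-odd n
... | k , inj₁ refl = k , inj₂ refl
... | k , inj₂ refl = suc k , inj₁ (cong suc (sym (+-suc k k)))

module ConvergentNorms (n : ℕ) where
  open import Data.Integer using (ℤ; +_; -[1+_]; -_; ∣_∣)
    renaming (_+_ to _+ℤ_; _*_ to _*ℤ_; _-_ to _-ℤ_)
  open import Data.Integer.Properties using (pos-+; pos-*; +-injective; neg-involutive)
  open import Data.Integer.Tactic.RingSolver using () renaming (solve-∀ to ℤ-solve-∀)

  form : ℤ → ℤ → ℤ → ℤ → ℤ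
  form X Y X′ Y′ = X *ℤ X′ -ℤ + n *ℤ (Y *ℤ Y′)

  -- With X/Y and X′/Y′ the convergents p_{i−1}/q_{i−1} and p_{i−2}/q_{i−2}
  -- and s = (−1)^i, these are the classical identities for the i-th complete quotient (m + √n)/d.
  record Norms (s : ℤ) (m d e : ℕ) : Set where
    field
      X Y X′ Y′ : ℤ
      norm  : form X Y X Y ≡ s *ℤ + d
      norm′ : form X′ Y′ X′ Y′ ≡ - s *ℤ + e
      cross : form X Y X′ Y′ ≡ - s *ℤ + m

  a+b≡c⇒+a≡+c-+b : ∀ {a b c} → a + b ≡ c → + a ≡ + c -ℤ + b
  a+b≡c⇒+a≡+c-+b {a} {b} refl = trans (cancel (+ a) (+ b)) (cong (_-ℤ + b) (sym (pos-+ a b)))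
    where
    cancel : ∀ a b → a ≡ a +ℤ b -ℤ b
    cancel = ℤ-solve-∀

  private
    expand-norm : ∀ q X X′ Y Y′ N →
      (q *ℤ X +ℤ X′) *ℤ (q *ℤ X +ℤ X′) -ℤ N *ℤ ((q *ℤ Y +ℤ Y′) *ℤ (q *ℤ Y +ℤ Y′))
      ≡ q *ℤ q *ℤ (X *ℤ X -ℤ N *ℤ (Y *ℤ Y)) +ℤ + 2 *ℤ q *ℤ (X *ℤ X′ -ℤ N *ℤ (Y *ℤ Y′))
        +ℤ (X′ *ℤ X′ -ℤ N *ℤ (Y′ *ℤ Y′))
    expand-norm = ℤ-solve-∀

    expand-cross : ∀ q X X′ Y Y′ N → (q *ℤ X +ℤ X′) *ℤ X -ℤ N *ℤ ((q *ℤ Y +ℤ Y′) *ℤ Y)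
      ≡ q *ℤ (X *ℤ X -ℤ N *ℤ (Y *ℤ Y)) +ℤ (X *ℤ X′ -ℤ N *ℤ (Y *ℤ Y′))
    expand-cross = ℤ-solve-∀

    collect-norm : ∀ q s d m e → q *ℤ q *ℤ (s *ℤ d) +ℤ + 2 *ℤ q *ℤ (- s *ℤ m) +ℤ - s *ℤ e
      ≡ - s *ℤ (e +ℤ q *ℤ m -ℤ q *ℤ (q *ℤ d -ℤ m))
    collect-norm = ℤ-solve-∀

    collect-cross : ∀ q s d m → q *ℤ (s *ℤ d) +ℤ - s *ℤ m ≡ - - s *ℤ (q *ℤ d -ℤ m)
    collect-cross = ℤ-solve-∀

    s≡--s : ∀ s d → s *ℤ d ≡ - - s *ℤ d
    s≡--s = ℤ-solve-∀

  -- The step α ↦ 1/(α − q) of the expansion, on the convergents: (X, Y) ↦ (q X + X′, q Y + Y′).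
  norms-next : ∀ {s m d e} q {m′ e′} → m′ + m ≡ q * d → e′ + q * m′ ≡ e + q * m →
    Norms s m d e → Norms (- s) m′ e′ d
  norms-next {s} {m} {d} {e} q {m′} {e′} shift shift′ N = record
    { X = + q *ℤ X +ℤ X′ ; Y = + q *ℤ Y +ℤ Y′ ; X′ = X ; Y′ = Y
    ; norm = norm-next ; norm′ = trans norm (s≡--s s (+ d)) ; cross = cross-next }
    where
    open Norms N
    open ≡-Reasoning
    m′≡ : + m′ ≡ + q *ℤ + d -ℤ + m
    m′≡ = trans (a+b≡c⇒+a≡+c-+b shift) (cong (_-ℤ + m) (pos-* q d))
    e′≡ : + e′ ≡ + e +ℤ + q *ℤ + m -ℤ + q *ℤ + m′
    e′≡ = trans (a+b≡c⇒+a≡+c-+b shift′)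
      (cong₂ _-ℤ_ (trans (pos-+ e (q * m)) (cong (+ e +ℤ_) (pos-* q m))) (pos-* q m′))
    norm-next : form (+ q *ℤ X +ℤ X′) (+ q *ℤ Y +ℤ Y′) (+ q *ℤ X +ℤ X′) (+ q *ℤ Y +ℤ Y′) ≡ - s *ℤ + e′
    norm-next = begin
      form (+ q *ℤ X +ℤ X′) (+ q *ℤ Y +ℤ Y′) (+ q *ℤ X +ℤ X′) (+ q *ℤ Y +ℤ Y′)
        ≡⟨ expand-norm (+ q) X X′ Y Y′ (+ n) ⟩
      + q *ℤ + q *ℤ form X Y X Y +ℤ + 2 *ℤ + q *ℤ form X Y X′ Y′ +ℤ form X′ Y′ X′ Y′
        ≡⟨ cong₂ (λ a b → + q *ℤ + q *ℤ a +ℤ + 2 *ℤ + q *ℤ b +ℤ form X′ Y′ X′ Y′) norm cross ⟩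
      + q *ℤ + q *ℤ (s *ℤ + d) +ℤ + 2 *ℤ + q *ℤ (- s *ℤ + m) +ℤ form X′ Y′ X′ Y′
        ≡⟨ cong (+ q *ℤ + q *ℤ (s *ℤ + d) +ℤ + 2 *ℤ + q *ℤ (- s *ℤ + m) +ℤ_) norm′ ⟩
      + q *ℤ + q *ℤ (s *ℤ + d) +ℤ + 2 *ℤ + q *ℤ (- s *ℤ + m) +ℤ - s *ℤ + e
        ≡⟨ collect-norm (+ q) s (+ d) (+ m) (+ e) ⟩
      - s *ℤ (+ e +ℤ + q *ℤ + m -ℤ + q *ℤ (+ q *ℤ + d -ℤ + m))
        ≡⟨ cong (λ z → - s *ℤ (+ e +ℤ + q *ℤ + m -ℤ + q *ℤ z)) m′≡ ⟨
      - s *ℤ (+ e +ℤ + q *ℤ + m -ℤ + q *ℤ + m′)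
        ≡⟨ cong (- s *ℤ_) e′≡ ⟨
      - s *ℤ + e′ ∎
    cross-next : form (+ q *ℤ X +ℤ X′) (+ q *ℤ Y +ℤ Y′) X Y ≡ - - s *ℤ + m′
    cross-next = begin
      form (+ q *ℤ X +ℤ X′) (+ q *ℤ Y +ℤ Y′) X Y   ≡⟨ expand-cross (+ q) X X′ Y Y′ (+ n) ⟩
      + q *ℤ form X Y X Y +ℤ form X Y X′ Y′        ≡⟨ cong₂ (λ a b → + q *ℤ a +ℤ b) norm cross ⟩
      + q *ℤ (s *ℤ + d) +ℤ - s *ℤ + m              ≡⟨ collect-cross (+ q) s (+ d) (+ m) ⟩
      - - s *ℤ (+ q *ℤ + d -ℤ + m)                 ≡⟨ cong (- - s *ℤ_) m′≡ ⟨
      - - s *ℤ + m′                                ∎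

  square : ∀ X → X *ℤ X ≡ + (∣ X ∣ * ∣ X ∣)
  square (+ k)     = sym (pos-* k k)
  square -[1+ k ] = refl

  norm⇒square≡n*square+c : ∀ {X Y c} → form X Y X Y ≡ + c → ∣ X ∣ * ∣ X ∣ ≡ n * (∣ Y ∣ * ∣ Y ∣) + c
  norm⇒square≡n*square+c {X} {Y} {c} N = +-injective (begin
    + (∣ X ∣ * ∣ X ∣)                      ≡⟨ square X ⟨
    X *ℤ X                                 ≡⟨ rearrange (X *ℤ X) (+ n *ℤ (Y *ℤ Y)) ⟩
    form X Y X Y +ℤ + n *ℤ (Y *ℤ Y)        ≡⟨ cong₂ _+ℤ_ N (cong (+ n *ℤ_) (square Y)) ⟩
    + c +ℤ + n *ℤ + (∣ Y ∣ * ∣ Y ∣)        ≡⟨ cong (+ c +ℤ_) (pos-* n _) ⟨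
    + c +ℤ + (n * (∣ Y ∣ * ∣ Y ∣))         ≡⟨ pos-+ c _ ⟨
    + (c + n * (∣ Y ∣ * ∣ Y ∣))            ≡⟨ cong +_ (+-comm c _) ⟩
    + (n * (∣ Y ∣ * ∣ Y ∣) + c)            ∎)
    where
    open ≡-Reasoning
    rearrange : ∀ a b → a ≡ a -ℤ b +ℤ b
    rearrange = ℤ-solve-∀

  norm⇒n*square≡square+c : ∀ {X Y c} → form X Y X Y ≡ - + c → n * (∣ Y ∣ * ∣ Y ∣) ≡ ∣ X ∣ * ∣ X ∣ + c
  norm⇒n*square≡square+c {X} {Y} {c} N = +-injective (begin
    + (n * (∣ Y ∣ * ∣ Y ∣))                ≡⟨ pos-* n _ ⟩
    + n *ℤ + (∣ Y ∣ * ∣ Y ∣)               ≡⟨ cong (+ n *ℤ_) (square Y) ⟨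
    + n *ℤ (Y *ℤ Y)                        ≡⟨ rearrange (X *ℤ X) (+ n *ℤ (Y *ℤ Y)) ⟩
    X *ℤ X -ℤ form X Y X Y                 ≡⟨ cong₂ _-ℤ_ (square X) N ⟩
    + (∣ X ∣ * ∣ X ∣) -ℤ - + c             ≡⟨ neg-neg (+ (∣ X ∣ * ∣ X ∣)) (+ c) ⟩
    + (∣ X ∣ * ∣ X ∣) +ℤ + c               ≡⟨ pos-+ _ c ⟨
    + (∣ X ∣ * ∣ X ∣ + c)                  ∎)
    where
    open ≡-Reasoning
    rearrange : ∀ a b → b ≡ a -ℤ (a -ℤ b)
    rearrange = ℤ-solve-∀
    neg-neg : ∀ a b → a -ℤ - b ≡ a +ℤ b
    neg-neg = ℤ-solve-∀

  norms-initial : ∀ {a e} → a * a + e ≡ n → Norms (- + 1) a e 1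
  norms-initial {a} {e} a²+e≡n = record
    { X = + a ; Y = + 1 ; X′ = + 1 ; Y′ = + 0
    ; norm = trans (cong (λ N → + a *ℤ + a -ℤ N *ℤ (+ 1 *ℤ + 1)) n≡) (solve-norm (+ a) (+ e))
    ; norm′ = solve-norm′ (+ n) ; cross = solve-cross (+ a) (+ n) }
    where
    n≡ : + n ≡ + a *ℤ + a +ℤ + e
    n≡ = trans (cong +_ (sym a²+e≡n)) (trans (pos-+ (a * a) e) (cong (_+ℤ + e) (pos-* a a)))
    solve-norm : ∀ a e → a *ℤ a -ℤ (a *ℤ a +ℤ e) *ℤ (+ 1 *ℤ + 1) ≡ - + 1 *ℤ e
    solve-norm = ℤ-solve-∀
    solve-norm′ : ∀ N → + 1 *ℤ + 1 -ℤ N *ℤ (+ 0 *ℤ + 0) ≡ - - + 1 *ℤ + 1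
    solve-norm′ = ℤ-solve-∀
    solve-cross : ∀ a N → a *ℤ + 1 -ℤ N *ℤ (+ 1 *ℤ + 0) ≡ - - + 1 *ℤ a
    solve-cross = ℤ-solve-∀

  -1^_ : ℕ → ℤ
  -1^ zero  = + 1
  -1^ suc k = - (-1^ k)

  -1^-parity : ∀ k → (-1^ k ≡ + 1 × (k + k) % 4 ≡ 0) ⊎ (-1^ k ≡ - + 1 × (k + k) % 4 ≡ 2)
  -1^-parity zero          = inj₁ (refl , refl)
  -1^-parity (suc zero)    = inj₂ (refl , refl)
  -1^-parity (suc (suc k)) = Sum.map two-more two-more (-1^-parity k)
    where
    [4+k+k]%4 : (suc (suc k) + suc (suc k)) % 4 ≡ (k + k) % 4
    [4+k+k]%4 = trans (cong (_% 4) 4+k+k≡k+k+4) ([m+n]%n≡m%n (k + k) 4)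
      where
      4+k+k≡k+k+4 : suc (suc k) + suc (suc k) ≡ k + k + 4
      4+k+k≡k+k+4 = solve (k ∷ [])
    two-more : ∀ {s r} → -1^ k ≡ s × (k + k) % 4 ≡ r →
      -1^ suc (suc k) ≡ s × (suc (suc k) + suc (suc k)) % 4 ≡ r
    two-more (sign , k+k%4) = trans (neg-involutive _) sign , trans [4+k+k]%4 k+k%4

  norm-two : ∀ {k m e} → Norms (-1^ k) m 2 e →
    (k + k) % 4 ≡ 0 × (∃₂ λ x y → x * x ≡ n * (y * y) + 2) ⊎
    (k + k) % 4 ≡ 2 × (∃₂ λ x y → n * (y * y) ≡ x * x + 2)
  norm-two {k} N with -1^-parity k
  ... | inj₁ (sign , 2k%4) =
    inj₁ (2k%4 , ∣ X ∣ , ∣ Y ∣ , norm⇒square≡n*square+c {X} {Y} (trans norm (cong (_*ℤ + 2) sign)))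
    where open Norms N
  ... | inj₂ (sign , 2k%4) =
    inj₂ (2k%4 , ∣ X ∣ , ∣ Y ∣ , norm⇒n*square≡square+c {X} {Y} (trans norm (cong (_*ℤ + 2) sign)))
    where open Norms N

module Expansion (n : ℕ) (a₀²<n : isqrt n * isqrt n < n) where
  open ConvergentNorms n

  a₀ : ℕ
  a₀ = isqrt n

  n<[1+a₀]² : n < suc a₀ * suc a₀
  n<[1+a₀]² = proj₂ (isqrt-spec n)

  0<a₀ : 0 < a₀
  0<a₀ = positive a₀²<n n<[1+a₀]²
    where
    positive : ∀ {a} → a * a < n → n < suc a * suc a → 0 < a
    positive {zero}  0<n (s≤s n≤0) = ⊥-elim (<⇒≱ 0<n n≤0)
    positive {suc a} _   _         = s≤s z≤n

  m≤a₀⇒m*m<n : ∀ {m} → m ≤ a₀ → m * m < n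
  m≤a₀⇒m*m<n m≤a₀ = ≤-<-trans (*-mono-≤ m≤a₀ m≤a₀) a₀²<n

  state : ℕ → ℕ × ℕ
  state = cqState n

  quotient : ℕ × ℕ → ℕ
  quotient (m , d) = flr n m d

  next-m : ℕ → ℕ → ℕ
  next-m m d = flr n m d * d ∸ m

  next : ℕ × ℕ → ℕ × ℕ
  next (m , d) = next-m m d , (n ∸ next-m m d * next-m m d) div d

  -- (m + √n)/d ↦ (m + √n)/e where d e = n − m², that is α ↦ −1/ᾱ for the conjugate ᾱ:
  -- on reduced states it runs the expansion backwards.
  reflect : ℕ × ℕ → ℕ × ℕ
  reflect (m , d) = m , (n ∸ m * m) div d

  -- α = (m + √n)/d is reduced (α > 1 and −1 < ᾱ < 0), and e = (n − m²)/d exactly.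
  record Reduced (s : ℕ × ℕ) (e : ℕ) : Set where
    field
      0<d    : 0 < proj₂ s
      m≤a₀   : proj₁ s ≤ a₀
      d≤m+a₀ : proj₂ s ≤ proj₁ s + a₀
      a₀<m+d : a₀ < proj₁ s + proj₂ s
      norm   : proj₁ s * proj₁ s + proj₂ s * e ≡ n
  open Reduced

  next≡ : ∀ {m d m′ e′} → 0 < d → next-m m d ≡ m′ → m′ * m′ + d * e′ ≡ n → next (m , d) ≡ (m′ , e′)
  next≡ {m′ = m′} 0<d refl norm′ = cong (m′ ,_) (cofactor {m = m′} 0<d norm′)

  reflect≡ : ∀ {s e} → Reduced s e → reflect s ≡ (proj₁ s , e)
  reflect≡ {s} r = cong (proj₁ s ,_) (cofactor {m = proj₁ s} (0<d r) (norm r))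

  Reduced-sym : ∀ {m d e} → Reduced (m , d) e → Reduced (m , e) d
  Reduced-sym {m} {d} {e} r = record
    { 0<d = 0<e ; m≤a₀ = m≤a₀ r ; d≤m+a₀ = e≤m+a₀ ; a₀<m+d = a₀<m+e
    ; norm = trans (cong (m * m +_) (*-comm e d)) (norm r) }
    where
    0<e : 0 < e
    0<e = n≢0⇒n>0 λ e≡0 → <⇒≢ (m≤a₀⇒m*m<n (m≤a₀ r)) (begin
      m * m          ≡⟨ +-identityʳ (m * m) ⟨
      m * m + 0      ≡⟨ cong (m * m +_) (*-zeroʳ d) ⟨
      m * m + d * 0  ≡⟨ cong (λ x → m * m + d * x) e≡0 ⟨
      m * m + d * e  ≡⟨ norm r ⟩
      n              ∎)
      where open ≡-Reasoning
    e≤m+a₀ : e ≤ m + a₀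
    e≤m+a₀ = ≮⇒≥ λ m+a₀<e → <⇒≱ n<[1+a₀]² (begin
      suc a₀ * suc a₀           ≤⟨ u≤x+y⇒u*u≤y*y+x*[y+u] d m (suc a₀) (subst (suc a₀ ≤_) (+-comm m d) (a₀<m+d r)) ⟩
      m * m + d * (m + suc a₀)  ≤⟨ +-monoʳ-≤ (m * m) (*-monoʳ-≤ d (subst (_≤ e) (sym (+-suc m a₀)) m+a₀<e)) ⟩
      m * m + d * e             ≡⟨ norm r ⟩
      n                         ∎)
      where open ≤-Reasoning
    a₀<m+e : a₀ < m + e
    a₀<m+e = ≰⇒> λ m+e≤a₀ → <⇒≱ a₀²<n (begin
      n              ≡⟨ norm r ⟨
      m * m + d * e  ≤⟨ e+y≤w⇒x≤w+y⇒y*y+x*e≤w*w d m e a₀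
                          (subst (_≤ a₀) (+-comm m e) m+e≤a₀) (subst (d ≤_) (+-comm m a₀) (d≤m+a₀ r)) ⟩
      a₀ * a₀        ∎)
      where open ≤-Reasoning

  reflect-reduced : ∀ {s e} → Reduced s e → Reduced (reflect s) (proj₂ s)
  reflect-reduced r = subst (λ t → Reduced t _) (sym (reflect≡ r)) (Reduced-sym r)

  module _ {m d e} (r : Reduced (m , d) e) where
    private
      q : ℕ
      q = flr n m d
      m′ : ℕ
      m′ = next-m m d

    qd≤m+a₀ : q * d ≤ m + a₀
    qd≤m+a₀ = [m-div-d]*d≤m (m + a₀) (0<d r)

    m+a₀<qd+d : m + a₀ < q * d + d
    m+a₀<qd+d = m<[m-div-d]*d+d (m + a₀) (0<d r)

    d≤qd : d ≤ q * d
    d≤qd = m≤n*m d q {{>-nonZero 0<q}}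
      where
      0<q : 0 < q
      0<q = n≢0⇒n>0 λ q≡0 → <⇒≱ (subst (λ x → m + a₀ < x * d + d) q≡0 m+a₀<qd+d) (d≤m+a₀ r)

    m≤qd : m ≤ q * d
    m≤qd = ≮⇒≥ λ qd<m → <-irrefl refl (begin-strict
      d      ≤⟨ d≤qd ⟩
      q * d  <⟨ qd<m ⟩
      m      ≤⟨ m≤a₀ r ⟩
      a₀     <⟨ +-cancelˡ-< m a₀ d (<-trans m+a₀<qd+d (+-monoˡ-< d qd<m)) ⟩
      d      ∎)
      where open ≤-Reasoning

    next-m+m≡qd : m′ + m ≡ q * d
    next-m+m≡qd = m∸n+n≡m m≤qd

    private
      m′≤a₀ : m′ ≤ a₀
      m′≤a₀ = +-cancelʳ-≤ m m′ a₀ (subst₂ _≤_ (sym next-m+m≡qd) (+-comm m a₀) qd≤m+a₀)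

      shifted : Σ ℕ λ e′ → m′ * m′ + d * e′ ≡ n × e′ + q * m′ ≡ e + q * m
      shifted = norm-after-shift q (0<d r) next-m+m≡qd (norm r) (<⇒≤ (m≤a₀⇒m*m<n m′≤a₀))

      next≡shifted : next (m , d) ≡ (m′ , proj₁ shifted)
      next≡shifted = next≡ {m} {d} (0<d r) refl (proj₁ (proj₂ shifted))

    next-shift : proj₂ (next (m , d)) + q * m′ ≡ e + q * m
    next-shift = trans (cong (λ x → proj₂ x + q * m′) next≡shifted) (proj₂ (proj₂ shifted))

    next-reduced : Reduced (next (m , d)) d
    next-reduced = subst (λ s → Reduced s d) (sym next≡shifted) (Reduced-sym (record
      { 0<d = 0<d r ; m≤a₀ = m′≤a₀ ; d≤m+a₀ = d≤m′+a₀ ; a₀<m+d = a₀<m′+d ; norm = proj₁ (proj₂ shifted) }))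
      where
      open ≤-Reasoning
      d≤m′+a₀ : d ≤ m′ + a₀
      d≤m′+a₀ = begin
        d       ≤⟨ d≤qd ⟩
        q * d   ≡⟨ next-m+m≡qd ⟨
        m′ + m  ≤⟨ +-monoʳ-≤ m′ (m≤a₀ r) ⟩
        m′ + a₀ ∎
      a₀<m′+d : a₀ < m′ + d
      a₀<m′+d = +-cancelˡ-< m a₀ (m′ + d) (begin-strict
        m + a₀        <⟨ m+a₀<qd+d ⟩
        q * d + d     ≡⟨ cong (_+ d) next-m+m≡qd ⟨
        m′ + m + d    ≡⟨ trans (cong (_+ d) (+-comm m′ m)) (+-assoc m m′ d) ⟩
        m + (m′ + d)  ∎)

    -- (m′ + √n)/d has the same integer part q as (m + √n)/d, so stepping from it undoes m ↦ m′.
    next-reflect-next : next (reflect (next (m , d))) ≡ reflect (m , d)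
    next-reflect-next = begin
      next (reflect (next (m , d)))  ≡⟨ cong next (reflect≡ next-reduced) ⟩
      next (m′ , d)                  ≡⟨ next≡ {m′} {d} (0<d r) m″≡m (norm r) ⟩
      (m , e)                        ≡⟨ reflect≡ r ⟨
      reflect (m , d)                ∎
      where
      open ≡-Reasoning
      q′≡q : flr n m′ d ≡ q
      q′≡q = div-unique q (0<d r)
        (subst (_≤ m′ + a₀) next-m+m≡qd (+-monoʳ-≤ m′ (m≤a₀ r)))
        (subst (m′ + a₀ <_) (trans (sym (+-assoc m′ m d)) (cong (_+ d) next-m+m≡qd)) (+-monoʳ-< m′ (a₀<m+d r)))
      m″≡m : next-m m′ d ≡ m
      m″≡m = trans (cong (λ x → x * d ∸ m′) q′≡q) (trans (cong (_∸ m′) (sym next-m+m≡qd)) (m+n∸m≡n m′ m))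

  next-injective : ∀ {s s′ e e′} → Reduced s e → Reduced s′ e′ → next s ≡ next s′ → s ≡ s′
  next-injective {s} {s′} r r′ same = cong₂ _,_ (cong proj₁ reflect-same) (begin
    proj₂ s                   ≡⟨ cong proj₂ (reflect≡ (next-reduced r)) ⟨
    proj₂ (reflect (next s))  ≡⟨ cong (proj₂ ∘ reflect) same ⟩
    proj₂ (reflect (next s′)) ≡⟨ cong proj₂ (reflect≡ (next-reduced r′)) ⟩
    proj₂ s′                  ∎)
    where
    open ≡-Reasoning
    reflect-same : reflect s ≡ reflect s′
    reflect-same = begin
      reflect s                   ≡⟨ next-reflect-next r ⟨
      next (reflect (next s))     ≡⟨ cong (next ∘ reflect) same ⟩
      next (reflect (next s′))    ≡⟨ next-reflect-next r′ ⟩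
      reflect s′                  ∎

  quotient-2a₀⇒d≡1 : ∀ {m d e} → Reduced (m , d) e → flr n m d ≡ a₀ + a₀ → d ≡ 1
  quotient-2a₀⇒d≡1 {m} {d} r q≡2a₀ = ≤-antisym (*-cancelˡ-≤ q {{>-nonZero 0<q}} (begin
    q * d    ≤⟨ qd≤m+a₀ r ⟩
    m + a₀   ≤⟨ +-monoˡ-≤ a₀ (m≤a₀ r) ⟩
    a₀ + a₀  ≡⟨ q≡2a₀ ⟨
    q        ≡⟨ *-identityʳ q ⟨
    q * 1    ∎)) (0<d r)
    where
    open ≤-Reasoning
    q = flr n m d
    0<q : 0 < q
    0<q = subst (0 <_) (sym q≡2a₀) (<-≤-trans 0<a₀ (m≤m+n a₀ a₀))

  d≡1⇒[m,d]≡[a₀,1] : ∀ {m d e} → Reduced (m , d) e → d ≡ 1 → (m , d) ≡ (a₀ , 1)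
  d≡1⇒[m,d]≡[a₀,1] {m} r refl = cong (_, 1) (≤-antisym (m≤a₀ r) (s≤s⁻¹ (subst (a₀ <_) (+-comm m 1) (a₀<m+d r))))

  a₀<d⇒quotient≡1 : ∀ {m d e} → Reduced (m , d) e → a₀ < d → flr n m d ≡ 1
  a₀<d⇒quotient≡1 {m} {d} r a₀<d = div-unique 1 (0<d r)
    (subst (_≤ m + a₀) (sym (*-identityˡ d)) (d≤m+a₀ r))
    (subst (m + a₀ <_) (cong (_+ d) (sym (*-identityˡ d))) (+-mono-≤-< (≤-trans (m≤a₀ r) (<⇒≤ a₀<d)) a₀<d))

  e₁ : ℕ
  e₁ = n ∸ a₀ * a₀

  a₀²+e₁≡n : a₀ * a₀ + e₁ ≡ n
  a₀²+e₁≡n = m+[n∸m]≡n (<⇒≤ a₀²<n)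

  next-over-1 : ∀ m → next (m , 1) ≡ (a₀ , e₁)
  next-over-1 m = next≡ {m} {1} (s≤s z≤n) m′≡a₀ (trans (cong (a₀ * a₀ +_) (*-identityˡ e₁)) a₀²+e₁≡n)
    where
    m′≡a₀ : next-m m 1 ≡ a₀
    m′≡a₀ = begin
      (m + a₀) / 1 * 1 ∸ m  ≡⟨ cong (λ x → x * 1 ∸ m) (n/1≡n (m + a₀)) ⟩
      (m + a₀) * 1 ∸ m      ≡⟨ cong (_∸ m) (*-identityʳ (m + a₀)) ⟩
      m + a₀ ∸ m            ≡⟨ m+n∸m≡n m a₀ ⟩
      a₀                    ∎
      where open ≡-Reasoning

  Reduced-first : Reduced (a₀ , e₁) 1
  Reduced-first = record
    { 0<d = m<n⇒0<n∸m a₀²<n ; m≤a₀ = ≤-refl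
    ; d≤m+a₀ = m≤n+o⇒m∸n≤o n (a₀ * a₀) (s≤s⁻¹ (subst (n <_) ([1+a]² a₀) n<[1+a₀]²))
    ; a₀<m+d = m<m+n a₀ (m<n⇒0<n∸m a₀²<n)
    ; norm = trans (cong (a₀ * a₀ +_) (*-identityʳ e₁)) a₀²+e₁≡n }
    where
    [1+a]² : ∀ a → suc a * suc a ≡ suc (a * a + (a + a))
    [1+a]² = solve-∀

  Reduced-[a₀,1] : Reduced (a₀ , 1) e₁
  Reduced-[a₀,1] = Reduced-sym Reduced-first

  next-[a₀,1] : next (a₀ , 1) ≡ state 1
  next-[a₀,1] = trans (next-over-1 a₀) (sym (next-over-1 0))

  state-reduced : ∀ i → Σ ℕ (Reduced (state (suc i)))
  state-reduced zero    = 1 , subst (λ s → Reduced s 1) (sym (next-over-1 0)) Reduced-first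
  state-reduced (suc i) = proj₂ (state (suc i)) , next-reduced (proj₂ (state-reduced i))

  state-reduced′ : ∀ {i} → 0 < i → Σ ℕ (Reduced (state i))
  state-reduced′ {suc i} _ = state-reduced i

  cancel-prefix : ∀ i t → state (suc i) ≡ state (suc (i + t)) → state 1 ≡ state (suc t)
  cancel-prefix zero    t same = same
  cancel-prefix (suc i) t same =
    cancel-prefix i t (next-injective (proj₂ (state-reduced i)) (proj₂ (state-reduced (i + t))) same)

  code : ℕ → Fin (suc a₀ * suc (a₀ + a₀))
  code i = Fin.combine (Fin.fromℕ< m<1+a₀) (Fin.fromℕ< d<1+2a₀)
    where
    r = proj₂ (state-reduced i)
    m<1+a₀ : proj₁ (state (suc i)) < suc a₀
    m<1+a₀ = s≤s (m≤a₀ r)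
    d<1+2a₀ : proj₂ (state (suc i)) < suc (a₀ + a₀)
    d<1+2a₀ = s≤s (≤-trans (d≤m+a₀ r) (+-monoˡ-≤ a₀ (m≤a₀ r)))

  code-injective : ∀ i j → code i ≡ code j → state (suc i) ≡ state (suc j)
  code-injective i j same = cong₂ _,_ (fromℕ<-injective (proj₁ parts)) (fromℕ<-injective (proj₂ parts))
    where
    parts = combine-injective _ _ _ _ same
    fromℕ<-injective : ∀ {x y b} .{x<b : x < b} .{y<b : y < b} → Fin.fromℕ< x<b ≡ Fin.fromℕ< y<b → x ≡ y
    fromℕ<-injective {x<b = x<b} {y<b} eq = trans (sym (toℕ-fromℕ< x<b)) (trans (cong Fin.toℕ eq) (toℕ-fromℕ< y<b))

  repeat⇒return : ∀ {i j} → i < j → state (suc i) ≡ state (suc j) → Σ ℕ λ R → 0 < R × state R ≡ (a₀ , 1)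
  repeat⇒return {i} i<j same with k , refl ← m≤n⇒∃[o]m+o≡n i<j =
    suc k , s≤s z≤n , next-injective (proj₂ (state-reduced k)) Reduced-[a₀,1] (trans back (sym next-[a₀,1]))
    where
    back : state (suc (suc k)) ≡ state 1
    back = sym (cancel-prefix i (suc k) (trans same (cong (state ∘ suc) (sym (+-suc i k)))))

  state-returns : Σ ℕ λ R → 0 < R × state R ≡ (a₀ , 1)
  state-returns =
    let i , j , i<j , same = pigeonhole (n<1+n _) (code ∘ Fin.toℕ)
    in repeat⇒return i<j (code-injective (Fin.toℕ i) (Fin.toℕ j) same)

  return⇒period : ∀ {R} → 0 < R → state R ≡ (a₀ , 1) → IsPeriod n R
  return⇒period {R} 0<R state-R = 0<R , λ { (suc i) _ → cong quotient (shifted i) }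
    where
    shifted : ∀ i → state (suc i + R) ≡ state (suc i)
    shifted zero    = trans (cong next state-R) next-[a₀,1]
    shifted (suc i) = cong next (shifted i)

  convergent-norms : ∀ i → Norms (-1^ suc i) (proj₁ (state (suc i))) (proj₂ (state (suc i))) (proj₁ (state-reduced i))
  convergent-norms zero    = subst (λ s → Norms (-1^ 1) (proj₁ s) (proj₂ s) 1) (sym (next-over-1 0))
                               (norms-initial a₀²+e₁≡n)
  convergent-norms (suc i) = norms-next (quotient (state (suc i))) (next-m+m≡qd r) (next-shift r) (convergent-norms i)
    where r = proj₂ (state-reduced i)

  module MinimalPeriod (P : ℕ) (minimal : IsMinPeriod n P) where
    0<P : 0 < P
    0<P = proj₁ (proj₁ minimal)

    state-P≡[a₀,1] : state P ≡ (a₀ , 1)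
    state-P≡[a₀,1] = d≡1⇒[m,d]≡[a₀,1] r (quotient-2a₀⇒d≡1 r cf-P)
      where
      R = proj₁ state-returns
      0<R = proj₁ (proj₂ state-returns)
      r = proj₂ (state-reduced′ 0<P)
      cf-P : cf n P ≡ a₀ + a₀
      cf-P = begin
        cf n P            ≡⟨ proj₂ (return⇒period 0<R (proj₂ (proj₂ state-returns))) P 0<P ⟨
        cf n (P + R)      ≡⟨ cong (cf n) (+-comm P R) ⟩
        cf n (R + P)      ≡⟨ proj₂ (proj₁ minimal) R 0<R ⟩
        cf n R            ≡⟨ cong quotient (proj₂ (proj₂ state-returns)) ⟩
        (a₀ + a₀) / 1     ≡⟨ n/1≡n (a₀ + a₀) ⟩
        a₀ + a₀           ∎
        where open ≡-Reasoning

    state≢[a₀,1] : ∀ {j} → 0 < j → j < P → state j ≢ (a₀ , 1)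
    state≢[a₀,1] 0<j j<P state-j = proj₂ minimal _ 0<j j<P (return⇒period 0<j state-j)

    palindrome : ∀ i j → i + suc j ≡ P → reflect (state (suc i)) ≡ state (suc j)
    palindrome zero j 1+j≡P = begin
      reflect (state 1)  ≡⟨ cong reflect (next-over-1 0) ⟩
      reflect (a₀ , e₁)  ≡⟨ reflect≡ Reduced-first ⟩
      (a₀ , 1)           ≡⟨ state-P≡[a₀,1] ⟨
      state P            ≡⟨ cong state 1+j≡P ⟨
      state (suc j)      ∎
      where open ≡-Reasoning
    palindrome (suc i) j i+j+2≡P = next-injective (reflect-reduced (proj₂ (state-reduced (suc i)))) (proj₂ (state-reduced j))
      (trans (next-reflect-next (proj₂ (state-reduced i))) (palindrome i (suc j) (trans (+-suc i (suc j)) i+j+2≡P)))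

module PrimeMod4≡3 {p} (p-prime : Prime p) (p%4≡3 : p % 4 ≡ 3) where

  x*x+y*y≢p : ∀ x y → x * x + y * y ≢ p
  x*x+y*y≢p x y eq = x*x+y*y%4≢3 x y (trans (cong (_% 4) eq) p%4≡3)

  isqrt²<p : isqrt p * isqrt p < p
  isqrt²<p with m≤n⇒m<n∨m≡n (proj₁ (isqrt-spec p))
  ... | inj₁ lt = lt
  ... | inj₂ eq = ⊥-elim (x*x+y*y≢p (isqrt p) 0 (trans (+-identityʳ _) eq))

  open Expansion p isqrt²<p
  open Reduced
  open ConvergentNorms p using (Norms; norm-two; -1^_)

  2a₀<p : a₀ + a₀ < p
  2a₀<p = a*a<n⇒a+a<n {a₀} (subst (_≤ p) p%4≡3 (m%n≤m p 4)) isqrt²<p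

  d≡2⇒1+m≡a₀⇒a₀<e : ∀ {m d e} → Reduced (m , d) e → d ≡ 2 → suc m ≡ a₀ → a₀ < e
  d≡2⇒1+m≡a₀⇒a₀<e {m} {e = e} r refl 1+m≡a₀ = ≰⇒> λ e≤a₀ → x*x+y*y≢p a₀ 1 (≤-antisym (begin
    a₀ * a₀ + 1          ≡⟨ +-comm (a₀ * a₀) 1 ⟩
    suc (a₀ * a₀)        ≤⟨ isqrt²<p ⟩
    p                    ∎) (begin
    p                    ≡⟨ norm r ⟨
    m * m + 2 * e        ≤⟨ +-monoʳ-≤ (m * m) (*-monoʳ-≤ 2 (subst (e ≤_) (sym 1+m≡a₀) e≤a₀)) ⟩
    m * m + 2 * suc m    ≡⟨ [1+m]²+1 ⟩
    suc m * suc m + 1    ≡⟨ cong (λ a → a * a + 1) 1+m≡a₀ ⟩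
    a₀ * a₀ + 1          ∎))
    where
    open ≤-Reasoning
    [1+m]²+1 : m * m + 2 * suc m ≡ suc m * suc m + 1
    [1+m]²+1 = solve (m ∷ [])

  preceding-quotient≡1 : ∀ j → proj₂ (state (suc j)) ≡ 2 → suc (proj₁ (state (suc j))) ≡ a₀ → cf p j ≡ 1
  preceding-quotient≡1 zero    _   1+a₀≡a₀ =
    ⊥-elim (1+n≢n (trans (cong (suc ∘ proj₁) (sym (next-over-1 0))) 1+a₀≡a₀))
  preceding-quotient≡1 (suc j) d≡2 1+m≡a₀ =
    a₀<d⇒quotient≡1 r₀ (d≡2⇒1+m≡a₀⇒a₀<e (next-reduced r₀) d≡2 1+m≡a₀)
    where r₀ = proj₂ (state-reduced j)

  module Period (P : ℕ) (minimal : IsMinPeriod p P) where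
    open MinimalPeriod P minimal

    not-odd : ∀ k → P ≢ suc (k + k)
    not-odd k P≡1+2k = x*x+y*y≢p m d (subst (λ x → m * m + d * x ≡ p) e≡d (norm r))
      where
      m = proj₁ (state (suc k))
      d = proj₂ (state (suc k))
      r = proj₂ (state-reduced k)
      e≡d : proj₁ (state-reduced k) ≡ d
      e≡d = cong proj₂ (trans (sym (reflect≡ r)) (palindrome k k (trans (+-suc k k) (sym P≡1+2k))))

    period-even : Σ ℕ λ k → P ≡ suc k + suc k
    period-even with even-or-odd P
    ... | k     , inj₂ P≡1+2k = ⊥-elim (not-odd k P≡1+2k)
    ... | zero  , inj₁ P≡0    = ⊥-elim (<⇒≢ 0<P (sym P≡0))
    ... | suc k , inj₁ P≡2k   = k , P≡2k

    module Middle (k : ℕ) (P≡2k : P ≡ suc k + suc k) where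
      r = proj₂ (state-reduced k)
      m = proj₁ (state (suc k))
      d = proj₂ (state (suc k))
      q = flr p m d

      2m≡qd : m + m ≡ q * d
      2m≡qd = subst (λ x → x + m ≡ q * d) mirror (next-m+m≡qd r)
        where
        mirror : next-m m d ≡ m
        mirror = cong proj₁ (trans (sym (reflect≡ {state (suc (suc k))} (next-reduced r))) (palindrome (suc k) k (sym P≡2k)))

      d≡2 : d ≡ 2
      d≡2 = denominator-two {m = m} {d} q p-prime 2m≡qd (norm r) (0<d r) d<p d≢1
        where
        d≢1 : d ≢ 1
        d≢1 d≡1 = state≢[a₀,1] (s≤s z≤n) (subst (suc k <_) (sym P≡2k) (m<m+n (suc k) (s≤s z≤n)))
                    (d≡1⇒[m,d]≡[a₀,1] r d≡1)
        d<p : d < p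
        d<p = ≤-<-trans (≤-trans (d≤m+a₀ r) (+-monoˡ-≤ a₀ (m≤a₀ r))) 2a₀<p

      middle-quotient : cf p (suc k) ≡ m
      middle-quotient = *-cancelʳ-≡ q m 2 (trans (cong (q *_) (sym d≡2)) (trans (sym 2m≡qd) (sym (m*2≡m+m m))))

      middle-norms : Norms (-1^ suc k) m 2 (proj₁ (state-reduced k))
      middle-norms = subst (λ x → Norms (-1^ suc k) m x (proj₁ (state-reduced k))) d≡2 (convergent-norms k)

      period%4 : (p % 8 ≡ 3 → P % 4 ≡ 2) × (p % 8 ≡ 7 → P % 4 ≡ 0)
      period%4 = Sum.[ (λ (2k%4 , x , y , x²≡py²+2) →
                         (λ p%8≡3 → ⊥-elim (p%8≡3⇒x*x≢p*[y*y]+2 {p} p%8≡3 x y x²≡py²+2)) , (λ _ → P%4≡ 2k%4))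
                     , (λ (2k%4 , x , y , py²≡x²+2) →
                         (λ _ → P%4≡ 2k%4) , (λ p%8≡7 → ⊥-elim (p%8≡7⇒p*[y*y]≢x*x+2 {p} p%8≡7 x y py²≡x²+2))) ]′
                   (norm-two {suc k} middle-norms)
        where
        P%4≡ : ∀ {r} → (suc k + suc k) % 4 ≡ r → P % 4 ≡ r
        P%4≡ = trans (cong (_% 4) P≡2k)

      culminating : cf p (suc k) ≡ cf p 0 ⊎ (cf p (suc k) ≡ cf p 0 ∸ 1 × cf p k ≡ 1)
      culminating = Sum.[ almost , (λ m≡a₀ → inj₁ (trans middle-quotient (trans m≡a₀ (sym cf-0)))) ]′
                      (m≤n⇒m<n∨m≡n (m≤a₀ r))
        where
        cf-0 : cf p 0 ≡ a₀
        cf-0 = n/1≡n a₀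
        almost : m < a₀ → cf p (suc k) ≡ cf p 0 ⊎ (cf p (suc k) ≡ cf p 0 ∸ 1 × cf p k ≡ 1)
        almost m<a₀ = inj₂ (trans middle-quotient (cong (_∸ 1) (trans 1+m≡a₀ (sym cf-0))) ,
                            preceding-quotient≡1 k d≡2 1+m≡a₀)
          where
          1+m≡a₀ : suc m ≡ a₀
          1+m≡a₀ = ≤-antisym m<a₀ (s≤s⁻¹ (subst (a₀ <_) (trans (cong (m +_) d≡2) (+-comm m 2)) (a₀<m+d r)))

open PrimeMod4≡3.Period using (period-even)
open PrimeMod4≡3.Period.Middle using (period%4; culminating)

lemma3 : (p : ℕ) → Prime p → p % 4 ≡ 3 → (P : ℕ) → IsMinPeriod p P →
    Σ ℕ (λ k → P ≡ 2 * k
      × (p % 8 ≡ 3 → P % 4 ≡ 2)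
      × (p % 8 ≡ 7 → P % 4 ≡ 0)
      × (cf p k ≡ cf p 0 ⊎ (cf p k ≡ cf p 0 ∸ 1 × cf p (k ∸ 1) ≡ 1)))
lemma3 p p-prime p%4≡3 P minimal with period-even p-prime p%4≡3 P minimal
... | k , P≡2k =
  suc k , trans P≡2k (cong (suc k +_) (sym (+-identityʳ (suc k)))) ,
  proj₁ mod-8 , proj₂ mod-8 , culminating p-prime p%4≡3 P minimal k P≡2k
  where mod-8 = period%4 p-prime p%4≡3 P minimal k P≡2k
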